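{- Let $n\geq 2$, let $k_1\geq 0$ be an integer and $m=3k_1+2$ (with $m\geq 2$). Let $S$ be an $A$-set of $\overrightarrow{C_m}\Box \overrightarrow{C_n}$ and for each $j\in\{0,1,\dots,n-1\}$ let $i_j\in\{0,\dots,m-1\}$ be the index with $S\cap C_m^j=A_{i_j}$. Assume that for every $j\in\{1,\dots,n-1\}$ we have $i_j\equiv i_{j-1}+1 \pmod m$ or $i_j\equiv i_{j-1}-2 \pmod m$, and that $i_0\equiv i_{n-1}+1 \pmod m$ or $i_0\equiv i_{n-1}-2\pmod m$. Then $S$ is a dominating set of $\overrightarrow{C_m}\Box \overrightarrow{C_n}$.
   Context: For a digraph, a vertex $u$ dominates $v$ if $u=v$ or $uv$ is an arc; a dominating set is a set of vertices such that every vertex is dominated by one of them. The directed cycle $\overrightarrow{C_n}$ has vertex set $\{0,\dots,n-1\}$ (integers mod $n$) and arcs $x\to x+1\pmod n$. The Cartesian product $D_1\Box D_2$ has vertex set $V_1\times V_2$ and an arc $(x_1,x_2)\to(y_1,y_2)$ iff either $x_1\to y_1$ is an arc of $D_1$ and $x_2=y_2$, or $x_2\to y_2$ is an arc of $D_2$ and $x_1=y_1$. For $j\in\{0,\dots,n-1\}$, $C_m^j=\{(k,j)\mid k\in\{0,\dots,m-1\}\}$; a subset of $\{0,\dots,m-1\}$ is identified with the corresponding subset of $C_m^j$ via $k\leftrightarrow (k,j)$. With $m=3k_1+2$, let $A=\{0\}\cup\{2+3p\mid p=0,1,\dots,k_1-1\}\subseteq\{0,\dots,m-1\}$ (a set of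 $k_1+1$ vertices), and for $i\in\{0,\dots,m-1\}$ let $A_i=\{j\mid j-i \bmod m\in A\}$ be its translate by $i$ modulo $m$. A set $S$ of vertices of $\overrightarrow{C_m}\Box \overrightarrow{C_n}$ is an $A$-set if for every $j\in\{0,\dots,n-1\}$ there is $i\in\{0,\dots,m-1\}$ with $S\cap C_m^j=A_i$. -}

module Defs where

open import Data.Nat using (ℕ; zero; suc; _+_; _*_; _∸_; _<_; _≤_; NonZero)
open import Data.Nat.DivMod using (_%_)
open import Data.Fin using (Fin; toℕ)
open import Data.Product using (_×_; _,_; Σ; ∃; ∃-syntax; proj₁; proj₂)
open import Data.Sum using (_⊎_)
open import Function.Bundles using (_⇔_)
open import Relation.Binary.PropositionalEquality using (_≡_; subst; sym)
open import Data.Nat.Properties using (+-comm)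

3k+2-nonZero : ∀ k₁ → NonZero (3 * k₁ + 2)
3k+2-nonZero k₁ = subst NonZero (+-comm 2 (3 * k₁)) _

CycArc : (m : ℕ) → .{{NonZero m}} → Fin m → Fin m → Set
CycArc m x y = toℕ y ≡ suc (toℕ x) % m

ProdArc : (m n : ℕ) → .{{NonZero m}} → .{{NonZero n}} →
          Fin m × Fin n → Fin m × Fin n → Set
ProdArc m n (x₁ , x₂) (y₁ , y₂) =
  (CycArc m x₁ y₁ × x₂ ≡ y₂) ⊎ (CycArc n x₂ y₂ × x₁ ≡ y₁)

Dominates : (m n : ℕ) → .{{NonZero m}} → .{{NonZero n}} →
            Fin m × Fin n → Fin m × Fin n → Set
Dominates m n u v = u ≡ v ⊎ ProdArc m n u v

IsDominating : (m n : ℕ) → .{{NonZero m}} → .{{NonZero n}} →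
               (Fin m × Fin n → Set) → Set
IsDominating m n S = ∀ v → ∃[ u ] (S u × Dominates m n u v)

InA : (k₁ : ℕ) → ℕ → Set
InA k₁ a = a ≡ 0 ⊎ ∃[ p ] (p < k₁ × a ≡ 2 + 3 * p)

-- A_i = { j | (j - i) mod m ∈ A }, with m = 3k₁+2.
InAi : (k₁ : ℕ) → Fin (3 * k₁ + 2) → Fin (3 * k₁ + 2) → Set
InAi k₁ i j = InA k₁ (_%_ (toℕ j + ((3 * k₁ + 2) ∸ toℕ i)) (3 * k₁ + 2) {{3k+2-nonZero k₁}})

RowIs : (k₁ n : ℕ) → (Fin (3 * k₁ + 2) × Fin n → Set) →
        Fin n → Fin (3 * k₁ + 2) → Set
RowIs k₁ n S j i = ∀ (k : Fin (3 * k₁ + 2)) → S (k , j) ⇔ InAi k₁ i k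

IsASet : (k₁ n : ℕ) → (Fin (3 * k₁ + 2) × Fin n → Set) → Set
IsASet k₁ n S = ∀ (j : Fin n) → ∃[ i ] RowIs k₁ n S j i

Step : (m : ℕ) → .{{NonZero m}} → Fin m → Fin m → Set
Step m i i' = toℕ i' ≡ (toℕ i + 1) % m ⊎ toℕ i' ≡ (toℕ i + (m ∸ 2)) % m

module Submission where

-- Write m = 3k₁ + 2 and, for a vertex (x , j), let
-- a = (x − i_j) mod m be the offset of x in row j, so that (x , j) ∈ S iff a ∈ A.
-- The offsets split into three classes (`classify`):
--   • a ∈ A: the vertex lies in S and dominates itself;
--   • a = c + 1 with c ∈ A: its left neighbour (x − 1 , j) has offset c, so lies in S;
--   • a = 4 + 3p with p < k₁: the vertex below, (x , j′) with j′ the cyclic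
--     predecessor of j, lies in S.  Indeed i_j ≡ i_{j′} + 1 or i_j ≡ i_{j′} − 2, so
--     the offset of x in row j′ is 5 + 3p (mod m) or 2 + 3p, and both lie in A
--     (`gap-covered`); note 5 + 3(k₁ − 1) = m wraps around to 0.
-- The file first develops congruence modulo m on ℕ and the offset function with its
-- characterisation (`offset-unique`) and behaviour under predecessors (`offset-pred`),
-- then the classification of offsets, the covering of the third class from the row
-- below (`GapRows`), the cyclic predecessor in a directed cycle, and finally
-- assembles the theorem.

open import Defs
open import Data.Nat using (ℕ; zero; suc; _+_; _*_; _∸_; _≤_; _<_; NonZero; z≤n; s≤s)
open import Data.Nat.Properties
open import Data.Nat.DivMod using (_%_; m%n%n≡m%n; [m+n]%n≡m%n; %-distribˡ-+; m<n⇒m%n≡m; m%n<n; n%n≡0)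
open import Data.Fin using (Fin; zero; suc; toℕ; fromℕ; inject₁)
open import Data.Fin.Properties using (toℕ-fromℕ; toℕ-inject₁; toℕ<n)
open import Data.Product using (_×_; _,_; ∃-syntax)
open import Data.Sum using (_⊎_; inj₁; inj₂)
open import Function.Bundles using (Equivalence)
open import Level using (0ℓ)
open import Relation.Binary.Bundles using (Setoid)
import Relation.Binary.Construct.On as On
open import Relation.Binary.PropositionalEquality
open import Data.Nat.Solver using (module +-*-Solver)
open +-*-Solver using (solve; _:+_; _:=_; con)

module Congruence (m : ℕ) .{{_ : NonZero m}} where

  infix 4 _≋_
  _≋_ : ℕ → ℕ → Set
  a ≋ b = a % m ≡ b % m

  ≋-setoid : Setoid 0ℓ 0ℓ
  ≋-setoid = record
    { Carrier = ℕ ; _≈_ = _≋_ ; isEquivalence = On.isEquivalence (_% m) isEquivalence }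

  open import Relation.Binary.Reasoning.Setoid ≋-setoid

  %-≋ : ∀ a → a % m ≋ a
  %-≋ a = m%n%n≡m%n a m

  ≡%⇒≋ : ∀ {a b} → a ≡ b % m → a ≋ b
  ≡%⇒≋ {a} {b} e = trans (cong (_% m) e) (%-≋ b)

  +-congˡ : ∀ {a b} c → a ≋ b → a + c ≋ b + c
  +-congˡ {a} {b} c e = begin
    a + c          ≈⟨ %-distribˡ-+ a c m ⟩
    a % m + c % m  ≡⟨ cong (_+ c % m) e ⟩
    b % m + c % m  ≈⟨ sym (%-distribˡ-+ b c m) ⟩
    b + c          ∎

  +-congʳ : ∀ {a b} c → a ≋ b → c + a ≋ c + b
  +-congʳ {a} {b} c e = begin
    c + a  ≡⟨ +-comm c a ⟩
    a + c  ≈⟨ +-congˡ c e ⟩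
    b + c  ≡⟨ +-comm b c ⟩
    c + b  ∎

  +m-≋ : ∀ a → a + m ≋ a
  +m-≋ a = [m+n]%n≡m%n a m

  -- A summand c ≤ m can be cancelled: add m ∸ c to both sides.
  +-cancelʳ : ∀ {a b} c → c ≤ m → a + c ≋ b + c → a ≋ b
  +-cancelʳ {a} {b} c c≤m e = begin
    a                      ≈⟨ sym (+m-≋ a) ⟩
    a + m                  ≡⟨ sym (add-complement a) ⟩
    a + c + (m ∸ c)        ≈⟨ +-congˡ (m ∸ c) e ⟩
    b + c + (m ∸ c)        ≡⟨ add-complement b ⟩
    b + m                  ≈⟨ +m-≋ b ⟩
    b                      ∎
    where
    add-complement : ∀ x → x + c + (m ∸ c) ≡ x + m
    add-complement x = trans (+-assoc x c (m ∸ c)) (cong (x +_) (m+[n∸m]≡n c≤m))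

  -- The offset of X relative to I: the representative of X − I in [0, m).
  -- `InAi` is membership of this offset in A.
  offset : ℕ → ℕ → ℕ
  offset I X = (X + (m ∸ I)) % m

  offset-spec : ∀ {I} X → I ≤ m → offset I X + I ≋ X
  offset-spec {I} X I≤m = begin
    offset I X + I      ≈⟨ +-congˡ I (%-≋ (X + (m ∸ I))) ⟩
    X + (m ∸ I) + I     ≡⟨ trans (+-assoc X (m ∸ I) I) (cong (X +_) (m∸n+n≡m I≤m)) ⟩
    X + m               ≈⟨ +m-≋ X ⟩
    X                   ∎

  offset-unique : ∀ {I X c} → I ≤ m → c < m → c + I ≋ X → offset I X ≡ c
  offset-unique {I} {X} {c} I≤m c<m e =
    trans (sym (%-≋ (X + (m ∸ I)))) (trans same-class (m<n⇒m%n≡m c<m))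
    where
    same-class : offset I X ≋ c
    same-class = +-cancelʳ I I≤m (trans (offset-spec X I≤m) (sym e))

  offset-< : ∀ I X → offset I X < m
  offset-< I X = m%n<n (X + (m ∸ I)) m

  offset-pred : ∀ {I X X′ c} → I ≤ m → X ≡ suc X′ % m → offset I X ≡ suc c → offset I X′ ≡ c
  offset-pred {I} {X} {X′} {c} I≤m arc off = offset-unique I≤m c<m (+-cancelʳ 1 1≤m (begin
    c + I + 1       ≡⟨ +-comm (c + I) 1 ⟩
    suc c + I       ≡⟨ cong (_+ I) off ⟨
    offset I X + I  ≈⟨ offset-spec X I≤m ⟩
    X               ≈⟨ ≡%⇒≋ arc ⟩
    suc X′          ≡⟨ +-comm 1 X′ ⟩
    X′ + 1          ∎))
    where
    c<m : c < m
    c<m = <-trans (n<1+n c) (subst (_< m) off (offset-< I X))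
    1≤m : 1 ≤ m
    1≤m = ≤-trans (s≤s z≤n) c<m

data OffsetClass (k a : ℕ) : Set where
  member    : InA k a → OffsetClass k a
  successor : ∀ c → InA k c → a ≡ suc c → OffsetClass k a
  gap       : ∀ p → p < k → a ≡ 4 + 3 * p → OffsetClass k a

-- Passing from k to k + 1 shifts the classes {3, …, 3k + 4} of k + 1 down by 3.
classify-shift : ∀ {k a} → OffsetClass k a → OffsetClass (suc k) (3 + a)
classify-shift (member (inj₁ refl)) = successor 2 (inj₂ (0 , s≤s z≤n , refl)) refl
classify-shift (member (inj₂ (p , p<k , refl))) =
  member (inj₂ (suc p , s≤s p<k , cong (2 +_) (sym (*-suc 3 p))))
classify-shift (successor _ (inj₁ refl) refl) = gap 0 (s≤s z≤n) refl
classify-shift (successor _ (inj₂ (p , p<k , refl)) refl) =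
  successor (2 + 3 * suc p) (inj₂ (suc p , s≤s p<k , refl)) (cong (λ z → 3 + z) (sym (*-suc 3 p)))
classify-shift (gap p p<k refl) = gap (suc p) (s≤s p<k) (cong (4 +_) (sym (*-suc 3 p)))

classify : ∀ k a → a < 3 * k + 2 → OffsetClass k a
classify k       0                   _ = member (inj₁ refl)
classify k       1                   _ = successor 0 (inj₁ refl) refl
classify zero    (suc (suc a))       (s≤s (s≤s ()))
classify (suc k) 2                   _ = member (inj₂ (0 , s≤s z≤n , refl))
classify (suc k) (suc (suc (suc a))) a<m = classify-shift (classify k a a<m′)
  where
  a<m′ : a < 3 * k + 2
  a<m′ = ≤-pred (≤-pred (≤-pred (subst (4 + a ≤_) (cong (_+ 2) (*-suc 3 k)) a<m)))

-- The offsets in the third class are covered from the row below: if the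
-- row index steps by +1 or −2 from I′ to I, an offset 4 + 3p relative to I is
-- an offset 5 + 3p (mod m) or 2 + 3p relative to I′, and both lie in A.
module GapRows (k : ℕ) where

  m : ℕ
  m = 3 * k + 2

  instance
    m-nonZero : NonZero m
    m-nonZero = 3k+2-nonZero k

  open Congruence m
  open import Relation.Binary.Reasoning.Setoid ≋-setoid

  5+3p≡2+3[p+1] : ∀ p → 5 + 3 * p ≡ 2 + 3 * suc p
  5+3p≡2+3[p+1] p = cong (2 +_) (sym (*-suc 3 p))

  -- 5 + 3p ∈ A for p < k, where the last value 5 + 3(k − 1) = m wraps to 0.
  A-wrap : ∀ {p} → p < k → InA k ((5 + 3 * p) % m)
  A-wrap {p} p<k with m≤n⇒m<n∨m≡n p<k
  ... | inj₁ p+1<k = subst (InA k) (sym (m<n⇒m%n≡m 5+3p<m)) (inj₂ (suc p , p+1<k , 5+3p≡2+3[p+1] p))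
    where
    5+3p<m : 5 + 3 * p < m
    5+3p<m = subst (_< m) (trans (+-comm (3 * suc p) 2) (sym (5+3p≡2+3[p+1] p)))
               (+-monoˡ-< 2 (*-monoʳ-< 3 p+1<k))
  ... | inj₂ refl = inj₁ (trans (cong (_% m) 5+3p≡m) (n%n≡0 m))
    where
    5+3p≡m : 5 + 3 * p ≡ m
    5+3p≡m = trans (5+3p≡2+3[p+1] p) (+-comm 2 (3 * suc p))

  gap-covered : ∀ {I I′ X p} → I ≤ m → I′ ≤ m → p < k → offset I X ≡ 4 + 3 * p →
                I ≡ (I′ + 1) % m ⊎ I ≡ (I′ + (m ∸ 2)) % m → InA k (offset I′ X)
  gap-covered {I} {I′} {X} {p} I≤m I′≤m p<k off (inj₁ step) =
    subst (InA k) (sym (offset-unique I′≤m (m%n<n (5 + 3 * p) m) congruence)) (A-wrap p<k)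
    where
    congruence : (5 + 3 * p) % m + I′ ≋ X
    congruence = begin
      (5 + 3 * p) % m + I′  ≈⟨ +-congˡ I′ (%-≋ (5 + 3 * p)) ⟩
      5 + 3 * p + I′        ≡⟨ solve 2 (λ q i → con 5 :+ q :+ i := con 4 :+ q :+ (i :+ con 1)) refl (3 * p) I′ ⟩
      4 + 3 * p + (I′ + 1)  ≈⟨ +-congʳ (4 + 3 * p) (≡%⇒≋ step) ⟨
      4 + 3 * p + I         ≡⟨ cong (_+ I) off ⟨
      offset I X + I        ≈⟨ offset-spec X I≤m ⟩
      X                     ∎
  gap-covered {I} {I′} {X} {p} I≤m I′≤m p<k off (inj₂ step) =
    subst (InA k) (sym (offset-unique I′≤m 2+3p<m congruence)) (inj₂ (p , p<k , refl))
    where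
    2+3p<m : 2 + 3 * p < m
    2+3p<m = m+n≤o⇒n≤o 2 (subst (_< m) off (offset-< I X))
    congruence : 2 + 3 * p + I′ ≋ X
    congruence = begin
      2 + 3 * p + I′                  ≈⟨ +m-≋ (2 + 3 * p + I′) ⟨
      2 + 3 * p + I′ + m              ≡⟨ cong (2 + 3 * p + I′ +_) (m+[n∸m]≡n (m≤n+m 2 (3 * k))) ⟨
      2 + 3 * p + I′ + (2 + (m ∸ 2))  ≡⟨ solve 3 (λ q i r → con 2 :+ q :+ i :+ (con 2 :+ r) := con 4 :+ q :+ (i :+ r)) refl (3 * p) I′ (m ∸ 2) ⟩
      4 + 3 * p + (I′ + (m ∸ 2))      ≈⟨ +-congʳ (4 + 3 * p) (≡%⇒≋ step) ⟨
      4 + 3 * p + I                   ≡⟨ cong (_+ I) off ⟨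
      offset I X + I                  ≈⟨ offset-spec X I≤m ⟩
      X                               ∎

cyclic-pred : ∀ {n} .{{_ : NonZero n}} (x : Fin n) →
  ∃[ x′ ] (CycArc n x′ x × (toℕ x ≡ suc (toℕ x′) ⊎ (toℕ x ≡ 0 × toℕ x′ ≡ n ∸ 1)))
cyclic-pred {suc n} zero = fromℕ n , arc , inj₂ (refl , toℕ-fromℕ n)
  where
  arc : 0 ≡ suc (toℕ (fromℕ n)) % suc n
  arc = sym (trans (cong (λ z → suc z % suc n) (toℕ-fromℕ n)) (n%n≡0 (suc n)))
cyclic-pred {suc n} (suc x) = inject₁ x , arc , inj₁ (cong suc (sym (toℕ-inject₁ x)))
  where
  arc : suc (toℕ x) ≡ suc (toℕ (inject₁ x)) % suc n
  arc = sym (trans (cong (λ z → suc z % suc n) (toℕ-inject₁ x)) (m<n⇒m%n≡m (toℕ<n (suc x))))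

mainTheorem3 : (k₁ n : ℕ) → .{{_ : NonZero n}} → 2 ≤ n →
    (S : Fin (3 * k₁ + 2) × Fin n → Set) →
    IsASet k₁ n S →
    (i : Fin n → Fin (3 * k₁ + 2)) →
    (∀ (j : Fin n) → RowIs k₁ n S j (i j)) →
    (∀ (j j′ : Fin n) → toℕ j′ ≡ suc (toℕ j) → Step (3 * k₁ + 2) {{3k+2-nonZero k₁}} (i j) (i j′)) →
    (∀ (j₀ jₗ : Fin n) → toℕ j₀ ≡ 0 → toℕ jₗ ≡ n ∸ 1 → Step (3 * k₁ + 2) {{3k+2-nonZero k₁}} (i jₗ) (i j₀)) →
    IsDominating (3 * k₁ + 2) n {{3k+2-nonZero k₁}} S
mainTheorem3 k₁ n _ S _ i rows next wrap (x , j) = dominator (classify k₁ a (offset-< (toℕ (i j)) (toℕ x)))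
  where
  open GapRows k₁
  open Congruence m

  a : ℕ
  a = offset (toℕ (i j)) (toℕ x)

  bound : (r : Fin n) → toℕ (i r) ≤ m
  bound r = <⇒≤ (toℕ<n (i r))

  inS : ∀ {y r} → InAi k₁ (i r) y → S (y , r)
  inS {y} {r} = Equivalence.from (rows r y)

  row-step : ∀ {j′} → toℕ j ≡ suc (toℕ j′) ⊎ (toℕ j ≡ 0 × toℕ j′ ≡ n ∸ 1) → Step m (i j′) (i j)
  row-step {j′} (inj₁ consecutive) = next j′ j consecutive
  row-step {j′} (inj₂ (first , last)) = wrap j j′ first last

  dominator : OffsetClass k₁ a → ∃[ u ] (S u × Dominates m n u (x , j))
  dominator (member a∈A) = (x , j) , inS a∈A , inj₁ refl
  dominator (successor c c∈A a≡c+1) with cyclic-pred x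
  ... | x′ , arc , _ =
    (x′ , j) , inS (subst (InA k₁) (sym (offset-pred (bound j) arc a≡c+1)) c∈A) , inj₂ (inj₁ (arc , refl))
  dominator (gap p p<k a≡4+3p) with cyclic-pred j
  ... | j′ , arc , position =
    (x , j′) , inS (gap-covered (bound j) (bound j′) p<k a≡4+3p (row-step position)) , inj₂ (inj₂ (arc , refl))
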